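{- Let $p,q$ be primes with $2<p<q$ and $q=p+2$ (a twin prime pair). Then every integer greater than $g_2$ is representable.
   Context: Let $p,q$ be primes with $2<p<q$, and put $p'=(p-1)/2$, $q'=(q-1)/2$. Set $d_0=pq$, $d_1=p'q$, $d_2=pq'$, $d_3=(pq-1)/2$, and for integers $x,y,z,w$ put $f(x,y,z,w)=xd_0+yd_1+zd_2+wd_3$. An integer is representable if it equals $f(x,y,z,w)$ for some nonnegative integers $x,y,z,w$. Define $\kappa$ by $q=\kappa p+\lambda$ with $1\le\lambda\le p-1$, and put $g_0=f(p'-1,p-1,\kappa,-1)$ and $g_2=g_0-(p-3)d_3$. -}

module Defs where

open import Data.Nat as ℕ using (ℕ)
open import Data.Nat.DivMod using (_/_)
open import Data.Integer using (ℤ; +_; _+_; _*_; _-_; -_)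
open import Data.Product using (∃; _,_)
open import Relation.Binary.PropositionalEquality using (_≡_)

-- p' = (p-1)/2, q' = (q-1)/2 (natural-number division; exact for odd p, q)
half-pred : ℕ → ℕ
half-pred n = (n ℕ.∸ 1) / 2

d₀ d₁ d₂ d₃ : ℕ → ℕ → ℤ
d₀ p q = + (p ℕ.* q)
d₁ p q = + (half-pred p ℕ.* q)
d₂ p q = + (p ℕ.* half-pred q)
d₃ p q = + (half-pred (p ℕ.* q))

f : ℕ → ℕ → ℤ → ℤ → ℤ → ℤ → ℤ
f p q x y z w = x * d₀ p q + y * d₁ p q + z * d₂ p q + w * d₃ p q

Representable : ℕ → ℕ → ℤ → Set
Representable p q n =
  ∃ λ (x : ℕ) → ∃ λ (y : ℕ) → ∃ λ (z : ℕ) → ∃ λ (w : ℕ) →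
    n ≡ f p q (+ x) (+ y) (+ z) (+ w)

-- κ with q = κ p + λ, 1 ≤ λ ≤ p-1; for a prime q > p this is ⌊q/p⌋
κ : (p q : ℕ) → .{{_ : ℕ.NonZero p}} → ℕ
κ p q = q / p

g₀ : (p q : ℕ) → .{{_ : ℕ.NonZero p}} → ℤ
g₀ p q = f p q (+ (half-pred p) - + 1) (+ (p ℕ.∸ 1)) (+ κ p q) (- + 1)

g₂ : (p q : ℕ) → .{{_ : ℕ.NonZero p}} → ℤ
g₂ p q = g₀ p q - (+ p - + 3) * d₃ p q

-- Write p = 2k + 1, so q = 2k + 3, and put a = k q. Then d₁ = a, d₂ = a + 1, d₃ = a + (k + 1)
-- and d₀ = 2a + (2k + 3), so a combination of 2k copies of d₁, d₂, d₃ (d₀ counting twice) is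
-- 2k·a plus an excess built from 1, k + 1 and 2k + 3. Every r < (2k + 1)(k + 1) is such an
-- excess: write r = B(k + 1) + c with B ≤ 2k, c ≤ k, use B copies of d₃ and c of d₂, and when
-- B + c exceeds 2k trade two d₃'s and a d₂ for a d₀ (same excess, one unit less weight).
-- Since a < (2k + 1)(k + 1), every n ≥ 2k·a is 2k·a + j·a + r with r < a, hence
-- representable, and a direct computation gives g₂ = 2k·a − 1.
module Submission where

open import Defs
open import Data.Nat as ℕ
  using (ℕ; NonZero; zero; suc; _+_; _*_; _∸_; _≤_; _<_; s≤s; s≤s⁻¹; >-nonZero⁻¹)
open import Data.Nat.Properties
  using ( +-comm; *-comm; +-cancelʳ-≡; ≤-reflexive; ≤-total; <-trans; >⇒≢; m≤m+n; m+n∸m≡n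
        ; m≤n⇒∃[o]m+o≡n; *-monoʳ-≤; m*n≢0)
open import Data.Nat.DivMod
  using (_/_; _%_; m≡m%n+[m/n]*n; m%n<n; m*n/n≡m; m/n≡1+[m∸n]/n; m<n⇒m/n≡0; m<n*o⇒m/o<n)
open import Data.Nat.Divisibility using (divides)
open import Data.Nat.Primality using (Prime; prime⇒irreducible)
open import Data.Nat.Tactic.RingSolver using (solve; solve-∀)
open import Data.Integer as ℤ using (ℤ; _>_; +_; -_; _-_; +≤+) renaming (suc to sucℤ)
open import Data.Integer.Properties using (pos-+; pos-*; i<j⇒suc[i]≤j)
import Data.Integer.Tactic.RingSolver as ℤ-Solver
open import Data.List using (_∷_; [])
open import Data.Product using (∃; _,_)
open import Data.Sum using (inj₁; inj₂; [_,_])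
open import Function using (_∘_)
open import Relation.Binary.PropositionalEquality
  using (_≡_; _≢_; refl; sym; trans; cong; cong₂; subst; module ≡-Reasoning)
open import Relation.Nullary using (contradiction)

prime≢2⇒odd : ∀ {p} → Prime p → p ≢ 2 → ∃ λ k → p ≡ 1 + 2 * k
prime≢2⇒odd {p} p-prime p≢2 with p % 2 | m≡m%n+[m/n]*n p 2 | m%n<n p 2
... | 0 | p≡ | _ =
  contradiction (prime⇒irreducible p-prime (divides (p / 2) p≡)) [ (λ ()) , p≢2 ∘ sym ]
... | 1 | p≡ | _ = p / 2 , trans p≡ (cong suc (*-comm (p / 2) 2))
... | suc (suc _) | _ | s≤s (s≤s ())

half-pred-odd : ∀ k → half-pred (1 + 2 * k) ≡ k
half-pred-odd k = trans (cong (_/ 2) (*-comm 2 k)) (m*n/n≡m k 2)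

κ-twin : ∀ p .{{_ : NonZero p}} → 2 < p → κ p (p + 2) ≡ 1
κ-twin p 2<p = begin
  (p + 2) / p          ≡⟨ m/n≡1+[m∸n]/n (m≤m+n p 2) ⟩
  1 + (p + 2 ∸ p) / p  ≡⟨ cong (λ t → 1 + t / p) (m+n∸m≡n p 2) ⟩
  1 + 2 / p            ≡⟨ cong suc (m<n⇒m/n≡0 2<p) ⟩
  1                    ∎
  where open ≡-Reasoning

fℕ : ℕ → ℕ → ℕ → ℕ → ℕ → ℕ → ℕ
fℕ p q x y z w =
  x * (p * q) + y * (half-pred p * q) + z * (p * half-pred q) + w * half-pred (p * q)

f-pos : ∀ p q x y z w → f p q (+ x) (+ y) (+ z) (+ w) ≡ + fℕ p q x y z w
f-pos p q x y z w = sym (begin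
  + (x * D₀ + y * D₁ + z * D₂ + w * D₃)
    ≡⟨ pos-+ (x * D₀ + y * D₁ + z * D₂) (w * D₃) ⟩
  + (x * D₀ + y * D₁ + z * D₂) ℤ.+ + (w * D₃)
    ≡⟨ cong (ℤ._+ + (w * D₃)) (pos-+ (x * D₀ + y * D₁) (z * D₂)) ⟩
  + (x * D₀ + y * D₁) ℤ.+ + (z * D₂) ℤ.+ + (w * D₃)
    ≡⟨ cong (λ s → s ℤ.+ + (z * D₂) ℤ.+ + (w * D₃)) (pos-+ (x * D₀) (y * D₁)) ⟩
  + (x * D₀) ℤ.+ + (y * D₁) ℤ.+ + (z * D₂) ℤ.+ + (w * D₃)
    ≡⟨ cong₂ ℤ._+_ (cong₂ ℤ._+_ (cong₂ ℤ._+_ (pos-* x D₀) (pos-* y D₁)) (pos-* z D₂))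
                   (pos-* w D₃) ⟩
  f p q (+ x) (+ y) (+ z) (+ w) ∎)
  where
  open ≡-Reasoning
  D₀ D₁ D₂ D₃ : ℕ
  D₀ = p * q
  D₁ = half-pred p * q
  D₂ = p * half-pred q
  D₃ = half-pred (p * q)

fℕ-representable : ∀ p q x y z w → Representable p q (+ fℕ p q x y z w)
fℕ-representable p q x y z w = x , y , z , w , sym (f-pos p q x y z w)

fℕ-by-half-preds : ∀ p q {p′ q′ r} x y z w →
  half-pred p ≡ p′ → half-pred q ≡ q′ → half-pred (p * q) ≡ r →
  fℕ p q x y z w ≡ x * (p * q) + y * (p′ * q) + z * (p * q′) + w * r
fℕ-by-half-preds p q x y z w refl refl refl = refl

-- Adding d₀ + p d₃ clears the negative coefficients in g₂.
g₂-shift : ∀ p q .{{_ : NonZero p}} →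
  g₂ p q ℤ.+ + (p * q + p * half-pred (p * q))
    ≡ + fℕ p q (half-pred p) (p ∸ 1) (κ p q) 2
g₂-shift p q = begin
  g₂ p q ℤ.+ + (p * q + p * half-pred (p * q))
    ≡⟨ cong (λ s → g₂ p q ℤ.+ s)
         (trans (pos-+ (p * q) _) (cong (λ s → d₀ p q ℤ.+ s) (pos-* p _))) ⟩
  g₂ p q ℤ.+ (d₀ p q ℤ.+ + p ℤ.* d₃ p q)
    ≡⟨ shift (+ half-pred p) (+ (p ∸ 1)) (+ κ p q) (+ p) (d₀ p q) (d₁ p q) (d₂ p q) (d₃ p q) ⟩
  f p q (+ half-pred p) (+ (p ∸ 1)) (+ κ p q) (+ 2)
    ≡⟨ f-pos p q (half-pred p) (p ∸ 1) (κ p q) 2 ⟩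
  + fℕ p q (half-pred p) (p ∸ 1) (κ p q) 2 ∎
  where
  open ≡-Reasoning
  shift : ∀ x y z P e₀ e₁ e₂ e₃ →
    ((x - + 1) ℤ.* e₀ ℤ.+ y ℤ.* e₁ ℤ.+ z ℤ.* e₂ ℤ.+ (- + 1) ℤ.* e₃ ℤ.- (P - + 3) ℤ.* e₃)
      ℤ.+ (e₀ ℤ.+ P ℤ.* e₃)
    ≡ x ℤ.* e₀ ℤ.+ y ℤ.* e₁ ℤ.+ z ℤ.* e₂ ℤ.+ + 2 ℤ.* e₃
  shift = ℤ-Solver.solve-∀

sucℤ-cancelʳ : ∀ i j k → sucℤ (i ℤ.+ k) ≡ j ℤ.+ k → sucℤ i ≡ j
sucℤ-cancelʳ i j k eq = begin
  + 1 ℤ.+ i                  ≡⟨ ℤ-Solver.solve (i ∷ k ∷ []) ⟩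
  + 1 ℤ.+ (i ℤ.+ k) ℤ.- k    ≡⟨ cong (ℤ._- k) eq ⟩
  j ℤ.+ k ℤ.- k              ≡⟨ ℤ-Solver.solve (j ∷ k ∷ []) ⟩
  j                          ∎
  where open ≡-Reasoning

-- For p = 2k + 1, q = 2k + 3: x d₀ + y d₁ + z d₂ + w d₃ = (2x + y + z + w) d₁ + offset.
record Excess (k r : ℕ) : Set where
  constructor excess
  field
    x y z w : ℕ
    weight  : 2 * x + y + z + w ≡ 2 * k
    offset  : x * (3 + 2 * k) + z + w * suc k ≡ r

excess-without-carry : ∀ k B c y → B + (c + y) ≡ 2 * k → Excess k (c + B * suc k)
excess-without-carry k B c y B+c+y≡2k = excess 0 y c B weight refl
  where
  open ≡-Reasoning
  weight : y + c + B ≡ 2 * k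
  weight = begin
    y + c + B    ≡⟨ solve (y ∷ c ∷ B ∷ []) ⟩
    B + (c + y)  ≡⟨ B+c+y≡2k ⟩
    2 * k        ∎

-- A d₀ has the excess of two d₃'s and a d₂ but one unit less weight.
excess-with-carry : ∀ e f t → Excess (f + t + e) (f + t + (f + 2 * e + 2 * t) * suc (f + t + e))
excess-with-carry e f t =
  excess t 0 f (f + 2 * e) (solve (t ∷ f ∷ e ∷ [])) (solve (t ∷ f ∷ e ∷ []))

excess-digits : ∀ k B c → B ≤ 2 * k → c ≤ k → Excess k (c + B * suc k)
excess-digits k B c B≤2k c≤k
  with e , refl ← m≤n⇒∃[o]m+o≡n c≤k
  with f , B+f≡2k ← m≤n⇒∃[o]m+o≡n B≤2k
  with ≤-total c f
... | inj₁ c≤f with y , refl ← m≤n⇒∃[o]m+o≡n c≤f = excess-without-carry (c + e) B c y B+f≡2k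
... | inj₂ f≤c with t , refl ← m≤n⇒∃[o]m+o≡n f≤c
  with refl ← +-cancelʳ-≡ f B (f + 2 * e + 2 * t) (trans B+f≡2k (solve (f ∷ t ∷ e ∷ []))) =
  excess-with-carry e f t

excess-below : ∀ k r → r < suc (2 * k) * suc k → Excess k r
excess-below k r r<bound = subst (Excess k) (sym (m≡m%n+[m/n]*n r (suc k)))
  (excess-digits k (r / suc k) (r % suc k)
    (s≤s⁻¹ (m<n*o⇒m/o<n r<bound)) (s≤s⁻¹ (m%n<n r (suc k))))

module Twin (k : ℕ) .{{_ : NonZero k}} where

  p q a : ℕ
  p = 1 + 2 * k
  q = p + 2
  a = k * q

  instance
    a-nonZero : NonZero a
    a-nonZero = m*n≢0 k q

  2<p : 2 < p
  2<p = s≤s (*-monoʳ-≤ 2 (>-nonZero⁻¹ k))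

  half-pred-p : half-pred p ≡ k
  half-pred-p = half-pred-odd k

  -- The ring solver treats p, q and a as atoms, so its goals are written out in k.
  pq≡ : p * q ≡ 2 * a + (3 + 2 * k)
  pq≡ = identity
    where
    identity : (1 + 2 * k) * (1 + 2 * k + 2) ≡ 2 * (k * (1 + 2 * k + 2)) + (3 + 2 * k)
    identity = solve (k ∷ [])

  p[1+k]≡ : p * suc k ≡ a + 1
  p[1+k]≡ = identity
    where
    identity : (1 + 2 * k) * suc k ≡ k * (1 + 2 * k + 2) + 1
    identity = solve (k ∷ [])

  half-pred-q : half-pred q ≡ suc k
  half-pred-q = trans (cong half-pred q≡) (half-pred-odd (suc k))
    where
    q≡ : 1 + 2 * k + 2 ≡ 1 + 2 * suc k
    q≡ = solve (k ∷ [])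

  half-pred-pq : half-pred (p * q) ≡ a + suc k
  half-pred-pq = trans (cong half-pred (trans pq≡ (odd-form a k))) (half-pred-odd (a + suc k))
    where
    odd-form : ∀ a k → 2 * a + (3 + 2 * k) ≡ 1 + 2 * (a + suc k)
    odd-form = solve-∀

  fℕ-twin : ∀ x y z w →
    fℕ p q x y z w ≡ (2 * x + y + z + w) * a + (x * (3 + 2 * k) + z + w * suc k)
  fℕ-twin x y z w = begin
    fℕ p q x y z w
      ≡⟨ fℕ-by-half-preds p q x y z w half-pred-p half-pred-q half-pred-pq ⟩
    x * (p * q) + y * a + z * (p * suc k) + w * (a + suc k)
      ≡⟨ cong₂ (λ s t → x * s + y * a + z * t + w * (a + suc k)) pq≡ p[1+k]≡ ⟩
    x * (2 * a + (3 + 2 * k)) + y * a + z * (a + 1) + w * (a + suc k)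
      ≡⟨ regroup x y z w a k ⟩
    (2 * x + y + z + w) * a + (x * (3 + 2 * k) + z + w * suc k) ∎
    where
    open ≡-Reasoning
    regroup : ∀ x y z w a k →
      x * (2 * a + (3 + 2 * k)) + y * a + z * (a + 1) + w * (a + suc k)
        ≡ (2 * x + y + z + w) * a + (x * (3 + 2 * k) + z + w * suc k)
    regroup = solve-∀

  representable-above : ∀ m → Representable p q (+ (2 * k * a + m))
  representable-above m =
    subst (λ n → Representable p q (+ n)) sum≡ (fℕ-representable p q x (y + m / a) z w)
    where
    open ≡-Reasoning
    a<bound : a < suc (2 * k) * suc k
    a<bound = ≤-reflexive (trans (+-comm 1 a) (sym p[1+k]≡))
    open Excess (excess-below k (m % a) (<-trans (m%n<n m a) a<bound))
    shift-quotient : ∀ x y j z w a o →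
      (2 * x + (y + j) + z + w) * a + o ≡ (2 * x + y + z + w) * a + (o + j * a)
    shift-quotient = solve-∀
    sum≡ : fℕ p q x (y + m / a) z w ≡ 2 * k * a + m
    sum≡ = begin
      fℕ p q x (y + m / a) z w
        ≡⟨ fℕ-twin x (y + m / a) z w ⟩
      (2 * x + (y + m / a) + z + w) * a + (x * (3 + 2 * k) + z + w * suc k)
        ≡⟨ shift-quotient x y (m / a) z w a _ ⟩
      (2 * x + y + z + w) * a + (x * (3 + 2 * k) + z + w * suc k + m / a * a)
        ≡⟨ cong₂ (λ s t → s * a + (t + m / a * a)) weight offset ⟩
      2 * k * a + (m % a + m / a * a)
        ≡⟨ cong (λ t → 2 * k * a + t) (sym (m≡m%n+[m/n]*n m a)) ⟩
      2 * k * a + m ∎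

  suc-g₂ : sucℤ (g₂ p q) ≡ + (2 * k * a)
  suc-g₂ = sucℤ-cancelʳ (g₂ p q) (+ (2 * k * a)) (+ (p * q + p * half-pred (p * q)))
    (trans (cong sucℤ (g₂-shift p q)) (cong (λ n → + n) suc-fℕ≡))
    where
    open ≡-Reasoning
    expand : ∀ a k →
      suc (k * (2 * a + (3 + 2 * k)) + 2 * k * a + 1 * (a + 1) + 2 * (a + suc k))
        ≡ 2 * k * a + (2 * a + (3 + 2 * k) + (1 + 2 * k) * (a + suc k))
    expand = solve-∀
    suc-fℕ≡ : suc (fℕ p q (half-pred p) (p ∸ 1) (κ p q) 2)
               ≡ 2 * k * a + (p * q + p * half-pred (p * q))
    suc-fℕ≡ = begin
      suc (fℕ p q (half-pred p) (p ∸ 1) (κ p q) 2)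
        ≡⟨ cong suc (fℕ-by-half-preds p q (half-pred p) (p ∸ 1) (κ p q) 2
                       half-pred-p half-pred-q half-pred-pq) ⟩
      suc (half-pred p * (p * q) + 2 * k * a + κ p q * (p * suc k) + 2 * (a + suc k))
        ≡⟨ cong₂ (λ s t → suc (s * (p * q) + 2 * k * a + t * (p * suc k) + 2 * (a + suc k)))
             half-pred-p (κ-twin p 2<p) ⟩
      suc (k * (p * q) + 2 * k * a + 1 * (p * suc k) + 2 * (a + suc k))
        ≡⟨ cong₂ (λ s t → suc (k * s + 2 * k * a + 1 * t + 2 * (a + suc k))) pq≡ p[1+k]≡ ⟩
      suc (k * (2 * a + (3 + 2 * k)) + 2 * k * a + 1 * (a + 1) + 2 * (a + suc k))
        ≡⟨ expand a k ⟩
      2 * k * a + (2 * a + (3 + 2 * k) + p * (a + suc k))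
        ≡⟨ cong₂ (λ s t → 2 * k * a + (s + p * t)) pq≡ half-pred-pq ⟨
      2 * k * a + (p * q + p * half-pred (p * q)) ∎

  representable-above-g₂ : ∀ n → n > g₂ p q → Representable p q n
  representable-above-g₂ n g₂<n = above (subst (ℤ._≤ n) suc-g₂ (i<j⇒suc[i]≤j g₂<n))
    where
    above : + (2 * k * a) ℤ.≤ n → Representable p q n
    above (+≤+ 2ka≤n) with m , refl ← m≤n⇒∃[o]m+o≡n 2ka≤n = representable-above m

proposition8p2 : (p q : ℕ) → .{{_ : NonZero p}} → Prime p → Prime q →
    2 ℕ.< p → p ℕ.< q → q ≡ p ℕ.+ 2 →
    (n : ℤ) → n > g₂ p q → Representable p q n
proposition8p2 p q p-prime _ 2<p _ refl n g₂<n with prime≢2⇒odd p-prime (>⇒≢ 2<p)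
... | zero , refl = contradiction 2<p λ { (s≤s ()) }
... | suc k , refl = Twin.representable-above-g₂ (suc k) n g₂<n
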